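{- Let $G=(K\cup I,E)$ be a split graph and $(V,\mathcal{F})$ the split graph vertex shelling antimatroid defined on $G$. Then $\mathcal{F}_*=\operatorname{Flt}(K\cup I,\prec)$.
   Context: All graphs are finite and simple. A split graph $G=(K\cup I,E)$ has vertex set $V=K\cup I$ partitioned into a clique $K$ and an independent set $I$ (either may be empty), the partition being given. For $S\subseteq V$, $N(S)$ is the set of vertices of $V\setminus S$ adjacent to some vertex of $S$. A vertex is simplicial if its neighbours induce a clique. The split graph vertex shelling antimatroid $(V,\mathcal{F})$ on $G$: $F\subseteq V$ is feasible iff there is an ordering $(f_1,\dots,f_{|F|})$ of $F$ such that each $f_j$ is simplicial in $G\setminus\{f_1,\dots,f_{j-1}\}$. $\mathcal{F}_*$ is the family of $*$-feasible sets, i.e. feasible sets $F$ with $N(F)\subseteq K$. The poset $(K\cup I,\prec)$ is defined by $u\prec v$ iff $u\in K$, $v\in I$ and $u$ is adjacent to $v$ (together with reflexivity). A filter of a poset $(X,\le)$ is a subset $F\subseteq X$ such that $a\in F$, $b\in X$, $a\le b$ imply $b\in F$; $\operatorname{Flt}(X,\le)$ is the family of all filters. -}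

module Defs where

open import Data.Nat using (ℕ)
open import Data.Bool using (Bool; true; false)
open import Data.Fin using (Fin)
open import Data.Fin.Subset using (Subset; _∈_; _∉_)
open import Data.List using (List; []; _∷_)
import Data.List.Membership.Propositional as LM
open import Data.Product using (Σ; _×_; ∃)
open import Data.Unit using (⊤)
open import Relation.Binary.PropositionalEquality using (_≡_; _≢_)
open import Function.Bundles using (_⇔_)

-- A finite simple split graph on vertex set Fin n, with a given partition
-- V = K ∪ I (inK v ≡ true means v ∈ K, inK v ≡ false means v ∈ I).
record SplitGraph (n : ℕ) : Set where
  field
    adj    : Fin n → Fin n → Bool
    sym    : ∀ u v → adj u v ≡ adj v u
    irrefl : ∀ v → adj v v ≡ false
    inK    : Fin n → Bool
    clique : ∀ u v → inK u ≡ true → inK v ≡ true → u ≢ v → adj u v ≡ true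
    indep  : ∀ u v → inK u ≡ false → inK v ≡ false → adj u v ≡ false

module _ {n : ℕ} (G : SplitGraph n) where
  open SplitGraph G

  _∈L_ : Fin n → List (Fin n) → Set
  x ∈L xs = x LM.∈ xs

  _∉L_ : Fin n → List (Fin n) → Set
  x ∉L xs = x LM.∉ xs

  Simplicial : List (Fin n) → Fin n → Set
  Simplicial removed v =
    ∀ x y → x ∉L removed → y ∉L removed →
    adj v x ≡ true → adj v y ≡ true → x ≢ y → adj x y ≡ true

  -- a shelling sequence (f₁,…,f_k): each f_j not yet removed and simplicial
  -- in G ∖ {f₁,…,f_{j-1}}; `removed` holds the previously removed vertices
  ShellingSeq : List (Fin n) → List (Fin n) → Set
  ShellingSeq removed []       = ⊤
  ShellingSeq removed (f ∷ fs) =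
    f ∉L removed × Simplicial removed f × ShellingSeq (f ∷ removed) fs

  Feasible : Subset n → Set
  Feasible F = Σ (List (Fin n)) λ l → ShellingSeq [] l × (∀ x → (x ∈ F ⇔ x ∈L l))

  NbhdInK : Subset n → Set
  NbhdInK F = ∀ v → v ∉ F → ∀ u → u ∈ F → adj u v ≡ true → inK v ≡ true

  StarFeasible : Subset n → Set
  StarFeasible F = Feasible F × NbhdInK F

  data _≺_ : Fin n → Fin n → Set where
    ≺-refl : ∀ {v} → v ≺ v
    ≺-edge : ∀ {u v} → inK u ≡ true → inK v ≡ false → adj u v ≡ true → u ≺ v

  IsFilter : Subset n → Set
  IsFilter F = ∀ a b → a ∈ F → a ≺ b → b ∈ F

module Submission where

-- Both sides are characterised by the neighbourhood condition N(F) ⊆ K.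
--   * A set is a filter of ≺ iff N(F) ⊆ K: an upward step u ≺ v leaving F
--     would put an I-vertex into N(F), and conversely an I-vertex of N(F)
--     has a K-neighbour in F (independence of I rules out I-neighbours).
--   * Every set with N(F) ⊆ K is feasible: shell first the I-vertices of F
--     (their neighbours lie in K, a clique) and then the K-vertices of F
--     (once the I-vertices of F are gone, their remaining neighbours lie
--     in K).  Both phases are instances of one lemma: a duplicate-free list
--     of not-yet-removed vertices whose remaining neighbours all lie in K is
--     a shelling sequence, since such vertices are simplicial.
-- The theorem follows: *-feasible = feasible ∧ N(F) ⊆ K ⇔ N(F) ⊆ K ⇔ filter.

open import Defs
open import Data.Nat using (ℕ)
open import Data.Fin.Subset using (Subset)
open import Function.Bundles using (_⇔_)

open import Data.Bool using (true; false)
open import Data.Bool.Properties using () renaming (_≟_ to _≟ᵇ_)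
open import Data.Empty using (⊥-elim)
open import Data.Fin using (Fin)
open import Data.Fin.Subset using (_∈_)
open import Data.Fin.Subset.Properties using (_∈?_)
open import Data.List using (List; []; _∷_; _++_; filter; allFin; reverseAcc; reverse)
open import Data.List.Membership.Propositional using ()
  renaming (_∈_ to _∈ₗ_; _∉_ to _∉ₗ_)
open import Data.List.Membership.Propositional.Properties
  using (∈-filter⁺; ∈-filter⁻; ∈-allFin; ∈-++⁺ˡ; ∈-++⁺ʳ; ∈-++⁻)
open import Data.List.Relation.Unary.All as All using ()
open import Data.List.Relation.Unary.AllPairs using (_∷_)
open import Data.List.Relation.Unary.Any using (here; there)
open import Data.List.Relation.Unary.Any.Properties using (reverse⁺; reverse⁻)
open import Data.List.Relation.Unary.Unique.Propositional using (Unique)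
open import Data.List.Relation.Unary.Unique.Propositional.Properties using (filter⁺; allFin⁺)
open import Data.Product using (_×_; _,_; proj₁; proj₂)
open import Data.Sum using (inj₁; inj₂)
open import Data.Unit using (tt)
open import Function.Bundles using (Equivalence; mk⇔)
open import Relation.Binary.PropositionalEquality using (_≡_; refl; sym; trans)
open import Relation.Nullary using (Dec; yes; no)
open import Relation.Nullary.Decidable using (_×-dec_)
open import Relation.Unary using (Pred)
open import Level using (Level)

-- The elements of Fin n satisfying a decidable predicate, listed without
-- repetition; this turns a subset into a candidate shelling order.
module Enumeration {n : ℕ} {p : Level} {P : Pred (Fin n) p}
                   (P? : (x : Fin n) → Dec (P x)) where

  enum : List (Fin n)
  enum = filter P? (allFin n)

  enum-unique : Unique enum
  enum-unique = filter⁺ P? (allFin⁺ n)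

  enum⁺ : ∀ {x} → P x → x ∈ₗ enum
  enum⁺ {x} = ∈-filter⁺ P? (∈-allFin x)

  enum⁻ : ∀ {x} → x ∈ₗ enum → P x
  enum⁻ x∈ = proj₂ (∈-filter⁻ P? {xs = allFin n} x∈)

module _ {n : ℕ} (G : SplitGraph n) where
  open SplitGraph G hiding (sym)

  true≢false : true ≡ false → ∀ {A : Set} → A
  true≢false ()

  NeighboursInK : List (Fin n) → Fin n → Set
  NeighboursInK removed v =
    ∀ y → y ∉ₗ removed → adj v y ≡ true → inK y ≡ true

  neighboursInK-∷ : ∀ {removed v} x →
    NeighboursInK removed v → NeighboursInK (x ∷ removed) v
  neighboursInK-∷ x nbrs y y∉ = nbrs y (λ y∈ → y∉ (there y∈))

  neighboursInK⇒simplicial : ∀ {removed v} →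
    NeighboursInK removed v → Simplicial G removed v
  neighboursInK⇒simplicial nbrs x y x∉ y∉ vx vy x≢y =
    clique x y (nbrs x x∉ vx) (nbrs y y∉ vy) x≢y

  shelling : ∀ removed xs → Unique xs →
    (∀ x → x ∈ₗ xs → x ∉ₗ removed) →
    (∀ x → x ∈ₗ xs → NeighboursInK removed x) →
    ShellingSeq G removed xs
  shelling removed []       _             _     _    = tt
  shelling removed (x ∷ xs) (x∉xs ∷ uniq) fresh nbrs =
    fresh x (here refl) ,
    neighboursInK⇒simplicial (nbrs x (here refl)) ,
    shelling (x ∷ removed) xs uniq fresh′
      (λ y y∈ → neighboursInK-∷ x (nbrs y (there y∈)))
    where
      fresh′ : ∀ y → y ∈ₗ xs → y ∉ₗ x ∷ removed
      fresh′ y y∈ (here refl) = All.lookup x∉xs y∈ refl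
      fresh′ y y∈ (there y∈r) = fresh y (there y∈) y∈r

  -- Running one shelling sequence after another: the vertices removed by
  -- the first are accumulated in reverse order in front of `removed`.
  shelling-++ : ∀ removed xs ys → ShellingSeq G removed xs →
    ShellingSeq G (reverseAcc removed xs) ys → ShellingSeq G removed (xs ++ ys)
  shelling-++ removed []       ys _                  seq = seq
  shelling-++ removed (x ∷ xs) ys (x∉ , simp , rest) seq =
    x∉ , simp , shelling-++ (x ∷ removed) xs ys rest seq

  I-neighboursInK : ∀ {removed v} → inK v ≡ false → NeighboursInK removed v
  I-neighboursInK {v = v} v∈I y _ vy with inK y in y∈?
  ... | true  = refl
  ... | false = true≢false (trans (sym vy) (indep v y v∈I y∈?))

  filter⇔neighbourhoodInK : ∀ F → IsFilter G F ⇔ NbhdInK G F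
  filter⇔neighbourhoodInK F = mk⇔ toNbhd toFilter
    where
      toNbhd : IsFilter G F → NbhdInK G F
      toNbhd flt v v∉F u u∈F uv with inK v in v∈K? | inK u in u∈K?
      ... | true  | _     = refl
      ... | false | true  = ⊥-elim (v∉F (flt u v u∈F (≺-edge u∈K? v∈K? uv)))
      ... | false | false = true≢false (trans (sym uv) (indep u v u∈K? v∈K?))

      toFilter : NbhdInK G F → IsFilter G F
      toFilter nbhd a b a∈F ≺-refl = a∈F
      toFilter nbhd a b a∈F (≺-edge a∈K b∈I ab) with b ∈? F
      ... | yes b∈F = b∈F
      ... | no  b∉F = true≢false (trans (sym (nbhd b b∉F a a∈F ab)) b∈I)

  neighbourhoodInK⇒feasible : ∀ F → NbhdInK G F → Feasible G F
  neighbourhoodInK⇒feasible F nbhd =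
    Iₗ ++ Kₗ , shelling-++ [] Iₗ Kₗ phaseI phaseK , λ x → mk⇔ (listed x) (unlisted x)
    where
      open Enumeration (λ x → (x ∈? F) ×-dec (inK x ≟ᵇ false))
        renaming (enum to Iₗ; enum-unique to Iₗ-unique; enum⁺ to Iₗ⁺; enum⁻ to Iₗ⁻)
      open Enumeration (λ x → (x ∈? F) ×-dec (inK x ≟ᵇ true))
        renaming (enum to Kₗ; enum-unique to Kₗ-unique; enum⁺ to Kₗ⁺; enum⁻ to Kₗ⁻)

      phaseI : ShellingSeq G [] Iₗ
      phaseI = shelling [] Iₗ Iₗ-unique (λ _ _ ())
        (λ x x∈ → I-neighboursInK (proj₂ (Iₗ⁻ x∈)))

      -- After phase I the removed vertices are exactly those of Iₗ.
      removedI : List (Fin n)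
      removedI = reverse Iₗ

      freshK : ∀ x → x ∈ₗ Kₗ → x ∉ₗ removedI
      freshK x x∈K x∈I =
        true≢false (trans (sym (proj₂ (Kₗ⁻ x∈K))) (proj₂ (Iₗ⁻ (reverse⁻ x∈I))))

      -- A remaining I-neighbour of a K-vertex of F would lie in F (as it
      -- is not in N(F) ⊆ K), hence in Iₗ, hence already removed.
      K-neighboursInK : ∀ x → x ∈ₗ Kₗ → NeighboursInK removedI x
      K-neighboursInK x x∈K y y∉ xy with y ∈? F
      ... | no  y∉F = nbhd y y∉F x (proj₁ (Kₗ⁻ x∈K)) xy
      ... | yes y∈F with inK y in y∈K?
      ...   | true  = refl
      ...   | false = ⊥-elim (y∉ (reverse⁺ (Iₗ⁺ (y∈F , y∈K?))))

      phaseK : ShellingSeq G removedI Kₗ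
      phaseK = shelling removedI Kₗ Kₗ-unique freshK K-neighboursInK

      listed : ∀ x → x ∈ F → x ∈ₗ Iₗ ++ Kₗ
      listed x x∈F with inK x in x∈K?
      ... | false = ∈-++⁺ˡ (Iₗ⁺ (x∈F , x∈K?))
      ... | true  = ∈-++⁺ʳ Iₗ (Kₗ⁺ (x∈F , x∈K?))

      unlisted : ∀ x → x ∈ₗ Iₗ ++ Kₗ → x ∈ F
      unlisted x x∈ with ∈-++⁻ Iₗ x∈
      ... | inj₁ x∈I = proj₁ (Iₗ⁻ x∈I)
      ... | inj₂ x∈K = proj₁ (Kₗ⁻ x∈K)

mainTheorem8 : ∀ {n : ℕ} (G : SplitGraph n) (F : Subset n) →
               StarFeasible G F ⇔ IsFilter G F
mainTheorem8 G F = mk⇔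
  (λ (_ , nbhd) → from nbhd)
  (λ flt → neighbourhoodInK⇒feasible G F (to flt) , to flt)
  where open Equivalence (filter⇔neighbourhoodInK G F)
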